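{- Consider the following static algorithm on a set system $(\mathcal{S},\mathcal{E})$ with costs $1/C\le c_s\le 1$, $n=|\mathcal{E}|$, every element contained in at least one set, and $0<\epsilon<1/2$. Initialize $L=\lceil\log_{1+\epsilon}(Cn)\rceil+1$, $w(e)=(1+\epsilon)^{ -L}$ and $\ell(e)=L$ for every element, and $\ell(s)=L$ for every set. For rounds $t=L,L-1,\dots,1$: let $\mathcal{S}^{(t)}_{slack}=\{s\in\mathcal{S}: W(s)<(1+\epsilon)^{ -1}c_s\}$ (with $W(s)=\sum_{e\in s}w(e)$ computed at the beginning of the round) and $\mathcal{E}^{(t)}_{slack}=\{e\in\mathcal{E}: e\notin s\text{ for all } s\in\mathcal{S}\setminus\mathcal{S}^{(t)}_{slack}\}$; decrease $\ell(s)$ by one for every $s\in\mathcal{S}^{(t)}_{slack}$; for every $e\in\mathcal{E}^{(t)}_{slack}$ multiply $w(e)$ by $(1+\epsilon)$ and decrease $\ell(e)$ by one. Then at the end of this algorithm, for every element $e\in\mathcal{E}$ at least one set containing $e$ has level at least $1$, i.e. $\ell(e)\ge 1$.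
   Formalization: The costs $c_s$, the bound $C$ and the parameter $\epsilon$ are rational numbers. -}

module Defs where

open import Data.Bool using (Bool; true; false; if_then_else_; _∧_; _∨_; not)
open import Data.Nat as ℕ using (ℕ; zero; suc)
open import Data.Fin using (Fin; zero; suc)
open import Data.Fin.Subset using (Subset; _∈_)
open import Data.Fin.Subset.Properties using (_∈?_)
open import Data.Integer as ℤ using (ℤ)
open import Data.Rational using (ℚ; 0ℚ; 1ℚ; _+_; _*_; _<_; _≤_; 1/_; Positive; positive)
open import Data.Rational.Properties using (_<?_; pos⇒nonZero; pos+pos⇒pos)
open import Data.Product using (_×_)
open import Relation.Nullary using (does)

_^ℚ_ : ℚ → ℕ → ℚ
q ^ℚ zero  = 1ℚ
q ^ℚ suc k = q * (q ^ℚ k)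

recip : (q : ℚ) → .{{Positive q}} → ℚ
recip q = 1/_ q {{pos⇒nonZero q}}

ℕ→ℚ : ℕ → ℚ
ℕ→ℚ n = Data.Rational._/_ (ℤ.+ n) 1

sumFin : ∀ {n} → (Fin n → ℚ) → ℚ
sumFin {zero}  f = 0ℚ
sumFin {suc n} f = f zero + sumFin (λ i → f (suc i))

allFin : ∀ {m} → (Fin m → Bool) → Bool
allFin {zero}  p = true
allFin {suc m} p = p zero ∧ allFin (λ i → p (suc i))

-- k = ⌈ log_b x ⌉ (for b > 1, x > 0): k is the least natural number with b^k ≥ x
IsCeilLog : ℚ → ℚ → ℕ → Set
IsCeilLog b x k = (x ≤ b ^ℚ k) × (∀ j → j ℕ.< k → b ^ℚ j < x)

record State (n m : ℕ) : Set where
  constructor mkState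
  field
    w  : Fin n → ℚ
    lE : Fin n → ℤ
    lS : Fin m → ℤ
open State public

module Algorithm {n m : ℕ} (sets : Fin m → Subset n) (c : Fin m → ℚ)
                 (ε : ℚ) (ε>0 : 0ℚ < ε) where

  b : ℚ
  b = 1ℚ + ε

  instance
    b-pos : Positive b
    b-pos = pos+pos⇒pos 1ℚ {{_}} ε {{positive ε>0}}

  b⁻¹ : ℚ
  b⁻¹ = recip b

  mem : Fin m → Fin n → Bool
  mem s e = does (e ∈? sets s)

  W : State n m → Fin m → ℚ
  W st s = sumFin (λ e → if mem s e then w st e else 0ℚ)

  slackS : State n m → Fin m → Bool
  slackS st s = does (W st s <? b⁻¹ * c s)

  slackE : State n m → Fin n → Bool
  slackE st e = allFin (λ s → not (mem s e) ∨ slackS st s)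

  round : State n m → State n m
  round st = mkState
    (λ e → if slackE st e then w st e * b else w st e)
    (λ e → if slackE st e then lE st e ℤ.- ℤ.1ℤ else lE st e)
    (λ s → if slackS st s then lS st s ℤ.- ℤ.1ℤ else lS st s)

  init : ℕ → State n m
  init L = mkState (λ _ → b⁻¹ ^ℚ L) (λ _ → ℤ.+ L) (λ _ → ℤ.+ L)

  iterate : ℕ → State n m → State n m
  iterate zero    st = st
  iterate (suc k) st = iterate k (round st)

  final : ℕ → State n m
  final L = iterate L (init L)

module Submission where

-- With k rounds still to run, every element e is in one of two states:
--   * settled: ℓ(e) ≥ k+1 and some set s ∋ e has ℓ(s) ≥ k+1;
--   * rising (only possible for k ≥ 1): ℓ(e) ≥ k and w(e) = (1+ε)^{-k}.
-- Initially (k = L) every element is rising.  One round lowers each level by at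
-- most one, so settled elements stay settled.  A rising element that is not
-- slack has a tight set s ∋ e whose level is untouched, so it becomes settled;
-- a slack one has its weight multiplied by 1+ε and keeps rising.  Rising cannot
-- continue past k = 1: an element of weight (1+ε)^{-1} ≥ (1+ε)^{-1} c_s makes
-- every set containing it tight, so it is not slack (here the cover hypothesis
-- supplies such a set).  After all L rounds (k = 0) every element is settled,
-- which is the claim.

open import Defs
open import Data.Nat using (ℕ; suc)
open import Data.Fin using (Fin)
open import Data.Fin.Subset using (Subset; _∈_)
open import Data.Integer using (ℤ) renaming (_≤_ to _≤ℤ_; 1ℤ to 1ℤ)
open import Data.Rational using (ℚ; 0ℚ; 1ℚ; ½; _*_; _<_; _≤_; Positive)
open import Data.Product using (_×_; ∃-syntax)

open import Data.Bool using (Bool; true; false; if_then_else_; not; _∨_)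
open import Data.Empty using (⊥)
open import Data.Fin.Subset.Properties using (_∈?_)
open import Data.Product using (_,_; proj₁; proj₂)
open import Data.Sum using (_⊎_; inj₁; inj₂; [_,_]′)
open import Function using (_∘_)
open import Relation.Nullary using (yes; contradiction)
open import Relation.Nullary.Decidable using (dec-true; dec-false)
open import Relation.Binary.PropositionalEquality
import Data.Nat as ℕ
import Data.Nat.Properties as ℕP
import Data.Fin as F
import Data.Integer as ℤ
import Data.Integer.Properties as ℤP
import Data.Rational as ℚ
import Data.Rational.Properties as ℚP

-- A level that is at least j+1 is still at least j after possibly being
-- decreased by one; this is all a round does to any level.
level-after-round : ∀ j (x : ℤ) (decrease : Bool) → ℤ.+ suc j ≤ℤ x
                  → ℤ.+ j ≤ℤ (if decrease then x ℤ.- 1ℤ else x)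
level-after-round j x true  j<x = subst (ℤ.+ j ≤ℤ_) (ℤP.+-comm ℤ.-1ℤ x)
                                        (ℤP.i<j⇒i≤pred[j] (ℤP.suc[i]≤j⇒i<j j<x))
level-after-round j x false j<x = ℤP.≤-trans (ℤ.+≤+ (ℕP.n≤1+n j)) j<x

allFin-true : ∀ {m} (p : Fin m → Bool) → allFin p ≡ true → ∀ i → p i ≡ true
allFin-true p holds F.zero    with p F.zero
... | true = refl
allFin-true p holds (F.suc i) with p F.zero
... | true = allFin-true (λ j → p (F.suc j)) holds i

allFin-false : ∀ {m} (p : Fin m → Bool) → allFin p ≡ false → ∃[ i ] (p i ≡ false)
allFin-false {suc m} p fails with p F.zero in p0
... | true  = let i , pi = allFin-false (λ j → p (F.suc j)) fails in F.suc i , pi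
... | false = F.zero , p0

sumFin-nonNeg : ∀ {n} (f : Fin n → ℚ) → (∀ i → 0ℚ ≤ f i) → 0ℚ ≤ sumFin f
sumFin-nonNeg {ℕ.zero} f _  = ℚP.≤-refl
sumFin-nonNeg {suc n}  f nn =
  ℚP.+-mono-≤ (nn F.zero) (sumFin-nonNeg (λ j → f (F.suc j)) (λ j → nn (F.suc j)))

term≤sumFin : ∀ {n} (f : Fin n → ℚ) → (∀ i → 0ℚ ≤ f i) → ∀ i → f i ≤ sumFin f
term≤sumFin f nn F.zero = begin
    f F.zero                           ≡⟨ ℚP.+-identityʳ (f F.zero) ⟨
    f F.zero ℚ.+ 0ℚ                    ≤⟨ ℚP.+-monoʳ-≤ (f F.zero) (sumFin-nonNeg _ (λ j → nn (F.suc j))) ⟩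
    sumFin f                           ∎
  where open ℚP.≤-Reasoning
term≤sumFin f nn (F.suc i) = begin
    f (F.suc i)                        ≤⟨ term≤sumFin (λ j → f (F.suc j)) (λ j → nn (F.suc j)) i ⟩
    sumFin (λ j → f (F.suc j))         ≡⟨ ℚP.+-identityˡ _ ⟨
    0ℚ ℚ.+ sumFin (λ j → f (F.suc j))  ≤⟨ ℚP.+-monoˡ-≤ _ (nn F.zero) ⟩
    sumFin f                           ∎
  where open ℚP.≤-Reasoning

*-nonNeg : ∀ {p q} → 0ℚ ≤ p → 0ℚ ≤ q → 0ℚ ≤ p * q
*-nonNeg {p} {q} 0≤p 0≤q =
  ℚP.nonNegative⁻¹ (p * q) {{ℚP.nonNeg*nonNeg⇒nonNeg p {{ℚ.nonNegative 0≤p}} q {{ℚ.nonNegative 0≤q}}}}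

-- A Boolean is true or false, recorded as an equation (used where abstracting
-- the Boolean itself with 'with' would hide it from the lemmas applied).
bool-cases : ∀ (x : Bool) → x ≡ true ⊎ x ≡ false
bool-cases true  = inj₁ refl
bool-cases false = inj₂ refl

module Analysis {n m : ℕ} (sets : Fin m → Subset n) (c : Fin m → ℚ)
                (ε : ℚ) (ε>0 : 0ℚ < ε)
                (c≤1 : ∀ s → c s ≤ 1ℚ)
                (cover : ∀ e → ∃[ s ] (e ∈ sets s)) where
  open Algorithm sets c ε ε>0

  instance
    b⁻¹-pos : Positive b⁻¹
    b⁻¹-pos = ℚP.1/pos⇒pos b

  b⁻¹-nonNeg : 0ℚ ≤ b⁻¹
  b⁻¹-nonNeg = ℚP.<⇒≤ (ℚP.positive⁻¹ b⁻¹)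

  power-nonNeg : ∀ k → 0ℚ ≤ b⁻¹ ^ℚ k
  power-nonNeg ℕ.zero  = ℚP.<⇒≤ (ℚP.positive⁻¹ 1ℚ)
  power-nonNeg (suc k) = *-nonNeg b⁻¹-nonNeg (power-nonNeg k)

  raise-power : ∀ k → (b⁻¹ ^ℚ suc k) * b ≡ b⁻¹ ^ℚ k
  raise-power k = begin
      (b⁻¹ * (b⁻¹ ^ℚ k)) * b  ≡⟨ cong (_* b) (ℚP.*-comm b⁻¹ _) ⟩
      ((b⁻¹ ^ℚ k) * b⁻¹) * b  ≡⟨ ℚP.*-assoc (b⁻¹ ^ℚ k) b⁻¹ b ⟩
      (b⁻¹ ^ℚ k) * (b⁻¹ * b)  ≡⟨ cong ((b⁻¹ ^ℚ k) *_) (ℚP.*-inverseˡ b {{ℚP.pos⇒nonZero b}}) ⟩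
      (b⁻¹ ^ℚ k) * 1ℚ         ≡⟨ ℚP.*-identityʳ _ ⟩
      b⁻¹ ^ℚ k                ∎
    where open ≡-Reasoning

  NonNegWeights : State n m → Set
  NonNegWeights st = ∀ e → 0ℚ ≤ w st e

  round-nonNeg : ∀ st → NonNegWeights st → NonNegWeights (round st)
  round-nonNeg st nn e with slackE st e
  ... | true  = *-nonNeg (nn e) (ℚP.<⇒≤ (ℚP.positive⁻¹ b))
  ... | false = nn e

  weight≤W : ∀ st → NonNegWeights st → ∀ {e s} → e ∈ sets s → w st e ≤ W st s
  weight≤W st nn {e} {s} e∈s = subst (_≤ W st s) term-is-weight (term≤sumFin term term-nonNeg e)
    where
    term : Fin n → ℚ
    term x = if mem s x then w st x else 0ℚ
    term-nonNeg : ∀ x → 0ℚ ≤ term x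
    term-nonNeg x with mem s x
    ... | true  = nn x
    ... | false = ℚP.≤-refl
    term-is-weight : term e ≡ w st e
    term-is-weight rewrite dec-true (e ∈? sets s) e∈s = refl

  heavy⇒tight : ∀ st → NonNegWeights st → ∀ {e s} → e ∈ sets s
              → b⁻¹ * c s ≤ w st e → slackS st s ≡ false
  heavy⇒tight st nn {e} {s} e∈s heavy = dec-false (W st s ℚP.<? b⁻¹ * c s) λ slack →
    ℚP.<-irrefl refl (ℚP.<-≤-trans slack (ℚP.≤-trans heavy (weight≤W st nn e∈s)))

  slack-element⇒slack-set : ∀ st {e s} → slackE st e ≡ true → e ∈ sets s → slackS st s ≡ true
  slack-element⇒slack-set st {e} {s} slack e∈s =
    subst (λ x → not x ∨ slackS st s ≡ true) (dec-true (e ∈? sets s) e∈s)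
          (allFin-true _ slack s)

  blocking-set : ∀ st {e} → slackE st e ≡ false → ∃[ s ] (e ∈ sets s × slackS st s ≡ false)
  blocking-set st {e} notSlack with allFin-false _ notSlack
  ... | s , blocked with e ∈? sets s | slackS st s in isSlack | blocked
  ...   | yes e∈s | false | _  = s , e∈s , isSlack
  ...   | yes _   | true  | ()

  -- Since every element lies in some set and costs are at most 1, an element of
  -- weight (1+ε)⁻¹ is never slack.
  heavy-element-not-slack : ∀ st → NonNegWeights st → ∀ e → w st e ≡ b⁻¹ ^ℚ 1 → slackE st e ≡ false
  heavy-element-not-slack st nn e we with bool-cases (slackE st e)
  ... | inj₂ notSlack = notSlack
  ... | inj₁ slack    = contradiction (trans (sym (slack-element⇒slack-set st slack e∈s)) tight) λ ()
    where
    s = proj₁ (cover e)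
    e∈s = proj₂ (cover e)
    heavy : b⁻¹ * c s ≤ w st e
    heavy = subst (b⁻¹ * c s ≤_) (sym we) (ℚP.*-monoˡ-≤-nonNeg b⁻¹ {{ℚP.pos⇒nonNeg b⁻¹}} (c≤1 s))
    tight = heavy⇒tight st nn e∈s heavy

  tight-element-keeps-level : ∀ st {e} → slackE st e ≡ false → lE (round st) e ≡ lE st e
  tight-element-keeps-level st notSlack rewrite notSlack = refl

  tight-set-keeps-level : ∀ st {s} → slackS st s ≡ false → lS (round st) s ≡ lS st s
  tight-set-keeps-level st notSlack rewrite notSlack = refl

  slack-element-raised : ∀ st {e} → slackE st e ≡ true → w (round st) e ≡ w st e * b
  slack-element-raised st slack rewrite slack = refl

  Settled : ℕ → State n m → Fin n → Set
  Settled k st e = (ℤ.+ suc k ≤ℤ lE st e) × ∃[ s ] (e ∈ sets s × ℤ.+ suc k ≤ℤ lS st s)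

  Rising : ℕ → State n m → Fin n → Set
  Rising ℕ.zero  st e = ⊥
  Rising (suc k) st e = (ℤ.+ suc k ≤ℤ lE st e) × (w st e ≡ b⁻¹ ^ℚ suc k)

  record Invariant (k : ℕ) (st : State n m) : Set where
    field
      weights-nonNeg : NonNegWeights st
      set-levels     : ∀ s → ℤ.+ k ≤ℤ lS st s
      status         : ∀ e → Settled k st e ⊎ Rising k st e
  open Invariant

  -- Levels drop by at most one per round, so settled elements stay settled.
  settled-step : ∀ k st e → Settled (suc k) st e → Settled k (round st) e
  settled-step k st e (le , s , e∈s , ls) =
    level-after-round (suc k) _ (slackE st e) le , s , e∈s , level-after-round (suc k) _ (slackS st s) ls

  -- A non-slack element keeps its level and has a non-slack set, which keeps
  -- its level too.
  settles : ∀ k st → Invariant (suc k) st → ∀ e → ℤ.+ suc k ≤ℤ lE st e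
          → slackE st e ≡ false → Settled k (round st) e
  settles k st I e le notSlack =
    let s , e∈s , tight = blocking-set st {e} notSlack
    in subst (ℤ.+ suc k ≤ℤ_) (sym (tight-element-keeps-level st {e} notSlack)) le ,
       s , e∈s , subst (ℤ.+ suc k ≤ℤ_) (sym (tight-set-keeps-level st {s} tight)) (set-levels I s)

  -- A rising element either settles or is raised to the next power; in the
  -- last round it has weight (1+ε)⁻¹ and must settle.
  rising-step : ∀ k st → Invariant (suc k) st → ∀ e → Rising (suc k) st e
              → Settled k (round st) e ⊎ Rising k (round st) e
  rising-step ℕ.zero st I e (le , we) =
    inj₁ (settles ℕ.zero st I e le (heavy-element-not-slack st (weights-nonNeg I) e we))
  rising-step (suc k) st I e (le , we) with bool-cases (slackE st e)
  ... | inj₂ notSlack = inj₁ (settles (suc k) st I e le notSlack)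
  ... | inj₁ slack    = inj₂ (level-after-round (suc k) _ (slackE st e) le , raised)
    where
    raised : w (round st) e ≡ b⁻¹ ^ℚ suc k
    raised = begin
      w (round st) e           ≡⟨ slack-element-raised st slack ⟩
      w st e * b               ≡⟨ cong (_* b) we ⟩
      (b⁻¹ ^ℚ suc (suc k)) * b ≡⟨ raise-power (suc k) ⟩
      b⁻¹ ^ℚ suc k             ∎
      where open ≡-Reasoning

  round-step : ∀ k st → Invariant (suc k) st → Invariant k (round st)
  round-step k st I = record
    { weights-nonNeg = round-nonNeg st (weights-nonNeg I)
    ; set-levels     = λ s → level-after-round k _ (slackS st s) (set-levels I s)
    ; status         = λ e → [ inj₁ ∘ settled-step k st e , rising-step k st I e ]′ (status I e)
    }

  iterate-step : ∀ k st → Invariant k st → Invariant 0 (iterate k st)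
  iterate-step ℕ.zero  st I = I
  iterate-step (suc k) st I = iterate-step k (round st) (round-step k st I)

  init-invariant : ∀ L₀ → Invariant (suc L₀) (init (suc L₀))
  init-invariant L₀ = record
    { weights-nonNeg = λ _ → power-nonNeg (suc L₀)
    ; set-levels     = λ _ → ℤP.≤-refl
    ; status         = λ _ → inj₂ (ℤP.≤-refl , refl)
    }

  final-settled : ∀ L₀ e → Settled 0 (final (suc L₀)) e
  final-settled L₀ e with status (iterate-step (suc L₀) (init (suc L₀)) (init-invariant L₀)) e
  ... | inj₁ settled = settled

claimA2 : (n m : ℕ) (sets : Fin m → Subset n) (c : Fin m → ℚ) (C : ℚ) .{{_ : Positive C}}
    → (∀ s → recip C ≤ c s × c s ≤ 1ℚ)
    → (∀ e → ∃[ s ] (e ∈ sets s))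
    → (ε : ℚ) (ε>0 : 0ℚ < ε) → ε < ½
    → (L₀ : ℕ) → IsCeilLog (Algorithm.b sets c ε ε>0) (C * ℕ→ℚ n) L₀
    → let L = suc L₀
          st = Algorithm.final sets c ε ε>0 L
      in ∀ e → (∃[ s ] (e ∈ sets s × 1ℤ ≤ℤ lS st s)) × (1ℤ ≤ℤ lE st e)
claimA2 n m sets c C costs cover ε ε>0 _ L₀ _ e =
  let element-level , s , e∈s , set-level = final-settled L₀ e
  in (s , e∈s , set-level) , element-level
  where open Analysis sets c ε ε>0 (λ s → proj₂ (costs s)) cover
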